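{- Let $\ell\geq 1$ and let $X_1,X_2,\ldots,X_{2^\ell-1}$ be $(\ell-1)$-dimensional subspaces of $\mathbb{F}_2^\ell$ (not assumed distinct). If each nonzero element of $\mathbb{F}_2^\ell$ is contained in exactly $2^{\ell-1}-1$ of these $2^\ell-1$ subspaces, then $X_1,X_2,\ldots,X_{2^\ell-1}$ are pairwise distinct. -}

module Defs where

open import Data.Bool using (Bool; true; false; _xor_; if_then_else_)
open import Data.Nat using (ℕ; zero; suc; _+_)
open import Data.Fin using (Fin)
open import Data.Vec using (Vec; []; _∷_; zipWith; replicate)
open import Data.Product using (Σ; ∃; _×_)
open import Relation.Binary.PropositionalEquality using (_≡_)

𝔽₂^ : ℕ → Set
𝔽₂^ ℓ = Vec Bool ℓ

0ᵥ : ∀ {ℓ} → 𝔽₂^ ℓ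
0ᵥ {ℓ} = replicate ℓ false

_+ᵥ_ : ∀ {ℓ} → 𝔽₂^ ℓ → 𝔽₂^ ℓ → 𝔽₂^ ℓ
_+ᵥ_ = zipWith _xor_

linComb : ∀ {ℓ k} → Vec Bool k → Vec (𝔽₂^ ℓ) k → 𝔽₂^ ℓ
linComb [] [] = 0ᵥ
linComb (c ∷ cs) (b ∷ bs) = (if c then b else 0ᵥ) +ᵥ linComb cs bs

LinIndep : ∀ {ℓ k} → Vec (𝔽₂^ ℓ) k → Set
LinIndep {k = k} bs = ∀ (c : Vec Bool k) → linComb c bs ≡ 0ᵥ → c ≡ replicate k false

IsSubspaceOfDim : ∀ {ℓ} → ℕ → (𝔽₂^ ℓ → Bool) → Set
IsSubspaceOfDim {ℓ} d X =
  Σ (Vec (𝔽₂^ ℓ) d) λ bs →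
    LinIndep bs ×
    (∀ (v : 𝔽₂^ ℓ) → (X v ≡ true → ∃ λ c → linComb c bs ≡ v)
                   × ((∃ λ c → linComb c bs ≡ v) → X v ≡ true))

countTrue : ∀ {n} → (Fin n → Bool) → ℕ
countTrue {zero} p = 0
countTrue {suc n} p = (if p Fin.zero then 1 else 0) + countTrue (λ i → p (Fin.suc i))

-- Let fₖ be the indicator function of the complement of Xₖ.  As Xₖ is a
-- hyperplane, fₖ is a nonzero linear form and takes the value 1 at M = 2^(ℓ-1) points.
-- Fix i and put aₖ = #{v | fᵢ v = fₖ v = 1}.  Every v with fᵢ v = 1 is nonzero, so by
-- hypothesis it lies outside exactly (2^ℓ - 1) - (M - 1) = M of the Xₖ; double counting
-- gives Σₖ aₖ = M·M.  On the other hand 2aₖ ≥ M for every k (fᵢ xor fₖ is either zero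
-- or again a nonzero linear form), and aₖ = M when Xₖ = Xᵢ.  If Xⱼ = Xᵢ for some j ≠ i,
-- then 2·M·M = Σₖ 2aₖ ≥ (2^ℓ - 1)·M + 2M = 2·M·M + M, which is absurd.

module Submission where

open import Defs
open import Algebra.Bundles using (CommutativeRing)
open import Data.Bool using (Bool; true; false; _xor_; if_then_else_; not; _∧_; _∨_)
open import Data.Bool.Properties
  using (_≟_; xor-assoc; xor-identityˡ; xor-identityʳ; xor-same; ∧-idem;
         not-injective; xor-∧-commutativeRing)
open import Data.Fin using (Fin; zero; suc)
open import Data.Nat using (ℕ; zero; suc; _+_; _*_; _^_; _∸_; _≤_; _<_; _≰_)
open import Data.Nat.Properties
  using (+-identityʳ; +-comm; *-identityʳ; *-zeroʳ; *-distribʳ-+; +-cancelˡ-≡; +-cancelʳ-≡;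
         *-cancelˡ-≡; m+n≡0⇒m≡0; m+n≡0⇒n≡0; ≤-reflexive; ≤-trans; m≤m+n; m≤n⇒m≤n+o;
         m≤n⇒m≤o+n; +-monoʳ-≤; <⇒≱; m<m+n; m^n>0; m∸n+n≡m; m+n∸n≡m; m+[n∸m]≡n; +-∸-comm;
         +-*-semiring; +-commutativeSemigroup; module ≤-Reasoning)
open import Data.Nat.Tactic.RingSolver using (solve-∀)
open import Data.Product using (∃; _×_; _,_; proj₁; proj₂)
open import Data.Sum using (_⊎_; inj₁; inj₂)
open import Data.Vec using (Vec; []; _∷_)
open import Data.Vec.Properties using (zipWith-assoc; zipWith-identityˡ; zipWith-identityʳ; ≡-dec)
open import Function using (_∘_; mk⇔)
open import Function.Definitions using (Injective)
open import Relation.Binary.Definitions using (DecidableEquality)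
open import Relation.Binary.PropositionalEquality
open import Relation.Nullary using (¬_; does; contradiction)
open import Relation.Nullary.Decidable using (does-⇔; dec-false)

open import Algebra.Properties.Semiring.Sum +-*-semiring
  using (sum-syntax; sum-cong-≗; ∑-distrib-+; sum-replicate-zero)
open import Algebra.Properties.CommutativeSemigroup +-commutativeSemigroup
  using () renaming (interchange to +-interchange)
open import Algebra.Properties.CommutativeSemigroup
  (CommutativeRing.+-commutativeSemigroup xor-∧-commutativeRing)
  using () renaming (interchange to xor-interchange)

true≡false-elim : ∀ {A : Set} {b : Bool} → b ≡ true → b ≡ false → A
true≡false-elim refl ()

+ᵥ-assoc : ∀ {ℓ} (u v w : 𝔽₂^ ℓ) → (u +ᵥ v) +ᵥ w ≡ u +ᵥ (v +ᵥ w)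
+ᵥ-assoc = zipWith-assoc xor-assoc

+ᵥ-identityˡ : ∀ {ℓ} (u : 𝔽₂^ ℓ) → 0ᵥ +ᵥ u ≡ u
+ᵥ-identityˡ = zipWith-identityˡ xor-identityˡ

+ᵥ-identityʳ : ∀ {ℓ} (u : 𝔽₂^ ℓ) → u +ᵥ 0ᵥ ≡ u
+ᵥ-identityʳ = zipWith-identityʳ xor-identityʳ

+ᵥ-self : ∀ {ℓ} (u : 𝔽₂^ ℓ) → u +ᵥ u ≡ 0ᵥ
+ᵥ-self []      = refl
+ᵥ-self (a ∷ u) = cong₂ _∷_ (xor-same a) (+ᵥ-self u)

+ᵥ-interchange : ∀ {ℓ} (u v w x : 𝔽₂^ ℓ) → (u +ᵥ v) +ᵥ (w +ᵥ x) ≡ (u +ᵥ w) +ᵥ (v +ᵥ x)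
+ᵥ-interchange []      []      []      []      = refl
+ᵥ-interchange (a ∷ u) (b ∷ v) (c ∷ w) (d ∷ x) =
  cong₂ _∷_ (xor-interchange a b c d) (+ᵥ-interchange u v w x)

+ᵥ-cancelˡ : ∀ {ℓ} (u v : 𝔽₂^ ℓ) → u +ᵥ (u +ᵥ v) ≡ v
+ᵥ-cancelˡ u v = begin
  u +ᵥ (u +ᵥ v) ≡⟨ +ᵥ-assoc u u v ⟨
  (u +ᵥ u) +ᵥ v ≡⟨ cong (_+ᵥ v) (+ᵥ-self u) ⟩
  0ᵥ +ᵥ v       ≡⟨ +ᵥ-identityˡ v ⟩
  v             ∎
  where open ≡-Reasoning

+ᵥ-cancelʳ : ∀ {ℓ} (u v : 𝔽₂^ ℓ) → (u +ᵥ v) +ᵥ v ≡ u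
+ᵥ-cancelʳ u v = begin
  (u +ᵥ v) +ᵥ v ≡⟨ +ᵥ-assoc u v v ⟩
  u +ᵥ (v +ᵥ v) ≡⟨ cong (u +ᵥ_) (+ᵥ-self v) ⟩
  u +ᵥ 0ᵥ       ≡⟨ +ᵥ-identityʳ u ⟩
  u             ∎
  where open ≡-Reasoning

+ᵥ≡0ᵥ⇒≡ : ∀ {ℓ} {u v : 𝔽₂^ ℓ} → u +ᵥ v ≡ 0ᵥ → u ≡ v
+ᵥ≡0ᵥ⇒≡ {u = u} {v} u+v≡0 = begin
  u             ≡⟨ +ᵥ-identityʳ u ⟨
  u +ᵥ 0ᵥ       ≡⟨ cong (u +ᵥ_) u+v≡0 ⟨
  u +ᵥ (u +ᵥ v) ≡⟨ +ᵥ-cancelˡ u v ⟩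
  v             ∎
  where open ≡-Reasoning

_≟ᵥ_ : ∀ {ℓ} → DecidableEquality (𝔽₂^ ℓ)
_≟ᵥ_ = ≡-dec _≟_

if-xor : ∀ {ℓ} a a′ (b : 𝔽₂^ ℓ) →
  (if a xor a′ then b else 0ᵥ) ≡ (if a then b else 0ᵥ) +ᵥ (if a′ then b else 0ᵥ)
if-xor true  true  b = sym (+ᵥ-self b)
if-xor true  false b = sym (+ᵥ-identityʳ b)
if-xor false true  b = sym (+ᵥ-identityˡ b)
if-xor false false b = sym (+ᵥ-identityˡ 0ᵥ)

linComb-+ᵥ : ∀ {ℓ k} (c c′ : Vec Bool k) (bs : Vec (𝔽₂^ ℓ) k) →
  linComb (c +ᵥ c′) bs ≡ linComb c bs +ᵥ linComb c′ bs
linComb-+ᵥ []      []        []       = sym (+ᵥ-identityˡ 0ᵥ)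
linComb-+ᵥ (a ∷ c) (a′ ∷ c′) (b ∷ bs) =
  trans (cong₂ _+ᵥ_ (if-xor a a′ b) (linComb-+ᵥ c c′ bs)) (+ᵥ-interchange _ _ _ _)

linComb-injective : ∀ {ℓ k} {bs : Vec (𝔽₂^ ℓ) k} → LinIndep bs →
  Injective _≡_ _≡_ (λ c → linComb c bs)
linComb-injective {bs = bs} indep {c} {c′} eq = +ᵥ≡0ᵥ⇒≡ (indep (c +ᵥ c′) (begin
  linComb (c +ᵥ c′) bs               ≡⟨ linComb-+ᵥ c c′ bs ⟩
  linComb c bs +ᵥ linComb c′ bs      ≡⟨ cong (_+ᵥ linComb c′ bs) eq ⟩
  linComb c′ bs +ᵥ linComb c′ bs     ≡⟨ +ᵥ-self _ ⟩
  0ᵥ                                 ∎))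
  where open ≡-Reasoning

𝟙 : Bool → ℕ
𝟙 b = if b then 1 else 0

sumᵥ : ∀ ℓ → (𝔽₂^ ℓ → ℕ) → ℕ
sumᵥ zero    f = f []
sumᵥ (suc ℓ) f = sumᵥ ℓ (λ v → f (false ∷ v)) + sumᵥ ℓ (λ v → f (true ∷ v))

count : ∀ ℓ → (𝔽₂^ ℓ → Bool) → ℕ
count ℓ p = sumᵥ ℓ (λ v → 𝟙 (p v))

𝟙-complement : ∀ b → 𝟙 b + 𝟙 (not b) ≡ 1
𝟙-complement true  = refl
𝟙-complement false = refl

sumᵥ-cong : ∀ ℓ {f g : 𝔽₂^ ℓ → ℕ} → (∀ v → f v ≡ g v) → sumᵥ ℓ f ≡ sumᵥ ℓ g
sumᵥ-cong zero    f≗g = f≗g []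
sumᵥ-cong (suc ℓ) f≗g =
  cong₂ _+_ (sumᵥ-cong ℓ (λ v → f≗g (false ∷ v))) (sumᵥ-cong ℓ (λ v → f≗g (true ∷ v)))

sumᵥ-distrib-+ : ∀ ℓ (f g : 𝔽₂^ ℓ → ℕ) → sumᵥ ℓ (λ v → f v + g v) ≡ sumᵥ ℓ f + sumᵥ ℓ g
sumᵥ-distrib-+ zero    f g = refl
sumᵥ-distrib-+ (suc ℓ) f g = trans
  (cong₂ _+_ (sumᵥ-distrib-+ ℓ (λ v → f (false ∷ v)) (λ v → g (false ∷ v)))
             (sumᵥ-distrib-+ ℓ (λ v → f (true ∷ v)) (λ v → g (true ∷ v))))
  (+-interchange (sumᵥ ℓ (λ v → f (false ∷ v))) (sumᵥ ℓ (λ v → g (false ∷ v)))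
                 (sumᵥ ℓ (λ v → f (true ∷ v))) (sumᵥ ℓ (λ v → g (true ∷ v))))

sumᵥ-*-distribʳ : ∀ ℓ (f : 𝔽₂^ ℓ → ℕ) c → sumᵥ ℓ (λ v → f v * c) ≡ sumᵥ ℓ f * c
sumᵥ-*-distribʳ zero    f c = refl
sumᵥ-*-distribʳ (suc ℓ) f c = trans
  (cong₂ _+_ (sumᵥ-*-distribʳ ℓ (λ v → f (false ∷ v)) c) (sumᵥ-*-distribʳ ℓ (λ v → f (true ∷ v)) c))
  (sym (*-distribʳ-+ c (sumᵥ ℓ (λ v → f (false ∷ v))) (sumᵥ ℓ (λ v → f (true ∷ v)))))

sumᵥ-const : ∀ ℓ c → sumᵥ ℓ (λ _ → c) ≡ 2 ^ ℓ * c
sumᵥ-const zero    c = sym (+-identityʳ c)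
sumᵥ-const (suc ℓ) c = begin
  sumᵥ ℓ (λ _ → c) + sumᵥ ℓ (λ _ → c) ≡⟨ cong₂ _+_ (sumᵥ-const ℓ c) (sumᵥ-const ℓ c) ⟩
  2 ^ ℓ * c + 2 ^ ℓ * c               ≡⟨ *-distribʳ-+ c (2 ^ ℓ) (2 ^ ℓ) ⟨
  (2 ^ ℓ + 2 ^ ℓ) * c                 ≡⟨ cong (λ t → (2 ^ ℓ + t) * c) (+-identityʳ (2 ^ ℓ)) ⟨
  2 ^ suc ℓ * c                       ∎
  where open ≡-Reasoning

sumᵥ-zero : ∀ ℓ → sumᵥ ℓ (λ _ → 0) ≡ 0
sumᵥ-zero ℓ = trans (sumᵥ-const ℓ 0) (*-zeroʳ (2 ^ ℓ))

sumᵥ-comm : ∀ ℓ d (h : 𝔽₂^ ℓ → 𝔽₂^ d → ℕ) →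
  sumᵥ ℓ (λ v → sumᵥ d (h v)) ≡ sumᵥ d (λ c → sumᵥ ℓ (λ v → h v c))
sumᵥ-comm zero    d h = refl
sumᵥ-comm (suc ℓ) d h = trans
  (cong₂ _+_ (sumᵥ-comm ℓ d (λ v → h (false ∷ v))) (sumᵥ-comm ℓ d (λ v → h (true ∷ v))))
  (sym (sumᵥ-distrib-+ d _ _))

sumᵥ-∑-comm : ∀ ℓ {n} (h : 𝔽₂^ ℓ → Fin n → ℕ) →
  sumᵥ ℓ (λ v → ∑[ k < n ] h v k) ≡ ∑[ k < n ] sumᵥ ℓ (λ v → h v k)
sumᵥ-∑-comm zero    h = refl
sumᵥ-∑-comm (suc ℓ) {n} h = trans
  (cong₂ _+_ (sumᵥ-∑-comm ℓ (λ v → h (false ∷ v))) (sumᵥ-∑-comm ℓ (λ v → h (true ∷ v))))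
  (sym (∑-distrib-+ {n} _ _))

sumᵥ-translate : ∀ ℓ (w : 𝔽₂^ ℓ) (f : 𝔽₂^ ℓ → ℕ) → sumᵥ ℓ (λ v → f (w +ᵥ v)) ≡ sumᵥ ℓ f
sumᵥ-translate zero    []          f = refl
sumᵥ-translate (suc ℓ) (false ∷ w) f =
  cong₂ _+_ (sumᵥ-translate ℓ w (λ v → f (false ∷ v))) (sumᵥ-translate ℓ w (λ v → f (true ∷ v)))
sumᵥ-translate (suc ℓ) (true ∷ w)  f = trans
  (cong₂ _+_ (sumᵥ-translate ℓ w (λ v → f (true ∷ v))) (sumᵥ-translate ℓ w (λ v → f (false ∷ v))))
  (+-comm (sumᵥ ℓ (λ v → f (true ∷ v))) (sumᵥ ℓ (λ v → f (false ∷ v))))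

count-partition : ∀ ℓ (p q r : 𝔽₂^ ℓ → Bool) → (∀ v → 𝟙 (p v) ≡ 𝟙 (q v) + 𝟙 (r v)) →
  count ℓ p ≡ count ℓ q + count ℓ r
count-partition ℓ p q r split =
  trans (sumᵥ-cong ℓ split) (sumᵥ-distrib-+ ℓ (𝟙 ∘ q) (𝟙 ∘ r))

count-splitʳ : ∀ ℓ (p q : 𝔽₂^ ℓ → Bool) →
  count ℓ p ≡ count ℓ (λ v → p v ∧ q v) + count ℓ (λ v → p v ∧ not (q v))
count-splitʳ ℓ p q = count-partition ℓ p _ _ (λ v → split (p v) (q v))
  where
  split : ∀ a b → 𝟙 a ≡ 𝟙 (a ∧ b) + 𝟙 (a ∧ not b)
  split true  true  = refl
  split true  false = refl
  split false _     = refl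

count-splitˡ : ∀ ℓ (p q : 𝔽₂^ ℓ → Bool) →
  count ℓ q ≡ count ℓ (λ v → p v ∧ q v) + count ℓ (λ v → not (p v) ∧ q v)
count-splitˡ ℓ p q = count-partition ℓ q _ _ (λ v → split (p v) (q v))
  where
  split : ∀ a b → 𝟙 b ≡ 𝟙 (a ∧ b) + 𝟙 (not a ∧ b)
  split true  true  = refl
  split true  false = refl
  split false _     = refl

count-xor : ∀ ℓ (p q : 𝔽₂^ ℓ → Bool) →
  count ℓ (λ v → p v xor q v) ≡ count ℓ (λ v → p v ∧ not (q v)) + count ℓ (λ v → not (p v) ∧ q v)
count-xor ℓ p q = count-partition ℓ _ _ _ (λ v → split (p v) (q v))
  where
  split : ∀ a b → 𝟙 (a xor b) ≡ 𝟙 (a ∧ not b) + 𝟙 (not a ∧ b)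
  split true  true  = refl
  split true  false = refl
  split false true  = refl
  split false false = refl

count-complement : ∀ ℓ (p : 𝔽₂^ ℓ → Bool) → count ℓ p + count ℓ (not ∘ p) ≡ 2 ^ ℓ
count-complement ℓ p = begin
  count ℓ p + count ℓ (not ∘ p)
    ≡⟨ count-partition ℓ (λ _ → true) p (not ∘ p) (sym ∘ 𝟙-complement ∘ p) ⟨
  sumᵥ ℓ (λ _ → 1)
    ≡⟨ sumᵥ-const ℓ 1 ⟩
  2 ^ ℓ * 1
    ≡⟨ *-identityʳ _ ⟩
  2 ^ ℓ
    ∎
  where open ≡-Reasoning

count-singleton : ∀ {ℓ} (w : 𝔽₂^ ℓ) → count ℓ (λ v → does (w ≟ᵥ v)) ≡ 1
count-singleton         []          = refl
count-singleton {suc ℓ} (false ∷ w) = cong₂ _+_ (count-singleton w) (sumᵥ-zero ℓ)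
count-singleton {suc ℓ} (true ∷ w)  = cong₂ _+_ (sumᵥ-zero ℓ) (count-singleton w)

count≡0⇒false : ∀ ℓ (p : 𝔽₂^ ℓ → Bool) → count ℓ p ≡ 0 → ∀ v → p v ≡ false
count≡0⇒false zero    p empty [] with p []
... | false = refl
count≡0⇒false (suc ℓ) p empty (false ∷ v) = count≡0⇒false ℓ _ (m+n≡0⇒m≡0 _ empty) v
count≡0⇒false (suc ℓ) p empty (true ∷ v)  = count≡0⇒false ℓ _ (m+n≡0⇒n≡0 _ empty) v

count≡2^ℓ⇒true : ∀ ℓ (p : 𝔽₂^ ℓ → Bool) → count ℓ p ≡ 2 ^ ℓ → ∀ v → p v ≡ true
count≡2^ℓ⇒true ℓ p full v = not-injective (count≡0⇒false ℓ (not ∘ p) complement-empty v)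
  where
  complement-empty : count ℓ (not ∘ p) ≡ 0
  complement-empty = +-cancelˡ-≡ (count ℓ p) _ _
    (trans (count-complement ℓ p) (trans (sym full) (sym (+-identityʳ _))))

false-everywhere⊎true-somewhere : ∀ ℓ (p : 𝔽₂^ ℓ → Bool) → (∀ v → p v ≡ false) ⊎ ∃ λ w → p w ≡ true
false-everywhere⊎true-somewhere zero    p with p [] in p[]
... | true  = inj₂ ([] , p[])
... | false = inj₁ λ { [] → p[] }
false-everywhere⊎true-somewhere (suc ℓ) p
  with false-everywhere⊎true-somewhere ℓ (λ v → p (false ∷ v))
     | false-everywhere⊎true-somewhere ℓ (λ v → p (true ∷ v))
... | inj₂ (w , pw) | _             = inj₂ (false ∷ w , pw)
... | inj₁ _        | inj₂ (w , pw) = inj₂ (true ∷ w , pw)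
... | inj₁ p₀       | inj₁ p₁       = inj₁ λ { (false ∷ v) → p₀ v ; (true ∷ v) → p₁ v }

∑-const : ∀ n c → ∑[ k < n ] c ≡ n * c
∑-const zero    c = refl
∑-const (suc n) c = cong (c +_) (∑-const n c)

countTrue≡∑ : ∀ {n} (p : Fin n → Bool) → countTrue p ≡ ∑[ k < n ] 𝟙 (p k)
countTrue≡∑ {zero}  p = refl
countTrue≡∑ {suc n} p = cong (𝟙 (p zero) +_) (countTrue≡∑ (p ∘ suc))

∑-𝟙-complement : ∀ {n} (p : Fin n → Bool) → ∑[ k < n ] 𝟙 (p k) + ∑[ k < n ] 𝟙 (not (p k)) ≡ n
∑-𝟙-complement {n} p = begin
  ∑[ k < n ] 𝟙 (p k) + ∑[ k < n ] 𝟙 (not (p k)) ≡⟨ ∑-distrib-+ (𝟙 ∘ p) (𝟙 ∘ not ∘ p) ⟨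
  ∑[ k < n ] (𝟙 (p k) + 𝟙 (not (p k)))          ≡⟨ sum-cong-≗ (𝟙-complement ∘ p) ⟩
  ∑[ k < n ] 1                                   ≡⟨ ∑-const n 1 ⟩
  n * 1                                          ≡⟨ *-identityʳ n ⟩
  n                                              ∎
  where open ≡-Reasoning

∑-≥-term : ∀ {n} (f : Fin n → ℕ) i → f i ≤ ∑[ k < n ] f k
∑-≥-term f zero    = m≤m+n (f zero) (∑[ k < _ ] f (suc k))
∑-≥-term f (suc i) = m≤n⇒m≤o+n (f zero) (∑-≥-term (f ∘ suc) i)

∑-≥-pair : ∀ {n} (f : Fin n → ℕ) {i j} → i ≢ j → f i + f j ≤ ∑[ k < n ] f k
∑-≥-pair f {zero}  {zero}  i≢j = contradiction refl i≢j
∑-≥-pair f {zero}  {suc j} _   = +-monoʳ-≤ (f zero) (∑-≥-term (f ∘ suc) j)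
∑-≥-pair f {suc i} {zero}  _   =
  ≤-trans (≤-reflexive (+-comm (f (suc i)) (f zero))) (+-monoʳ-≤ (f zero) (∑-≥-term (f ∘ suc) i))
∑-≥-pair f {suc i} {suc j} i≢j = m≤n⇒m≤o+n (f zero) (∑-≥-pair (f ∘ suc) (i≢j ∘ cong suc))

∑-lower-bound : ∀ {n} (b : Fin n → ℕ) {c i j} → i ≢ j → (∀ k → c ≤ b k) →
  n * c + ((b i ∸ c) + (b j ∸ c)) ≤ ∑[ k < n ] b k
∑-lower-bound {n} b {c} {i} {j} i≢j c≤b = begin
  n * c + (excess i + excess j)      ≤⟨ +-monoʳ-≤ (n * c) (∑-≥-pair excess i≢j) ⟩
  n * c + ∑[ k < n ] excess k        ≡⟨ cong (_+ ∑[ k < n ] excess k) (∑-const n c) ⟨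
  ∑[ k < n ] c + ∑[ k < n ] excess k ≡⟨ ∑-distrib-+ {n} (λ _ → c) excess ⟨
  ∑[ k < n ] (c + excess k)          ≡⟨ sum-cong-≗ (λ k → m+[n∸m]≡n (c≤b k)) ⟩
  ∑[ k < n ] b k                     ∎
  where
  open ≤-Reasoning
  excess : Fin n → ℕ
  excess k = b k ∸ c

∑-count-∧ : ∀ {ℓ n c} (p : 𝔽₂^ ℓ → Bool) (q : Fin n → 𝔽₂^ ℓ → Bool) →
  (∀ v → p v ≡ true → ∑[ k < n ] 𝟙 (q k v) ≡ c) →
  ∑[ k < n ] count ℓ (λ v → p v ∧ q k v) ≡ count ℓ p * c
∑-count-∧ {ℓ} {n} {c} p q column = begin
  ∑[ k < n ] count ℓ (λ v → p v ∧ q k v)     ≡⟨ sumᵥ-∑-comm ℓ (λ v k → 𝟙 (p v ∧ q k v)) ⟨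
  sumᵥ ℓ (λ v → ∑[ k < n ] 𝟙 (p v ∧ q k v)) ≡⟨ sumᵥ-cong ℓ row ⟩
  sumᵥ ℓ (λ v → 𝟙 (p v) * c)                 ≡⟨ sumᵥ-*-distribʳ ℓ (𝟙 ∘ p) c ⟩
  count ℓ p * c                              ∎
  where
  open ≡-Reasoning
  row : ∀ v → ∑[ k < n ] 𝟙 (p v ∧ q k v) ≡ 𝟙 (p v) * c
  row v with p v in pv
  ... | true  = trans (column v pv) (sym (+-identityʳ c))
  ... | false = sum-replicate-zero n

-- 𝟙 (H v) is the number of c with g c = v, so summing over v first counts every c once.
count-image : ∀ {ℓ d} (g : 𝔽₂^ d → 𝔽₂^ ℓ) {H : 𝔽₂^ ℓ → Bool} → Injective _≡_ _≡_ g →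
  (∀ v → (H v ≡ true → ∃ λ c → g c ≡ v) × ((∃ λ c → g c ≡ v) → H v ≡ true)) →
  count ℓ H ≡ 2 ^ d
count-image {ℓ} {d} g {H} g-injective image = begin
  count ℓ H                                      ≡⟨ sumᵥ-cong ℓ fibre-size ⟩
  sumᵥ ℓ (λ v → count d (λ c → does (g c ≟ᵥ v))) ≡⟨ sumᵥ-comm ℓ d _ ⟩
  sumᵥ d (λ c → count ℓ (λ v → does (g c ≟ᵥ v))) ≡⟨ sumᵥ-cong d (count-singleton ∘ g) ⟩
  sumᵥ d (λ _ → 1)                               ≡⟨ sumᵥ-const d 1 ⟩
  2 ^ d * 1                                      ≡⟨ *-identityʳ _ ⟩
  2 ^ d                                          ∎
  where
  open ≡-Reasoning
  fibre-size : ∀ v → 𝟙 (H v) ≡ count d (λ c → does (g c ≟ᵥ v))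
  fibre-size v with H v in Hv
  ... | false = sym (trans (sumᵥ-cong d (λ c → cong 𝟙 (dec-false (g c ≟ᵥ v) (missed c))))
                           (sumᵥ-zero d))
    where
    missed : ∀ c → g c ≢ v
    missed c gc≡v = true≡false-elim (proj₂ (image v) (c , gc≡v)) Hv
  ... | true with proj₁ (image v) Hv
  ...   | c₀ , gc₀≡v = sym (trans (sumᵥ-cong d (λ c → cong 𝟙 (same-fibre c))) (count-singleton c₀))
    where
    same-fibre : ∀ c → does (g c ≟ᵥ v) ≡ does (c₀ ≟ᵥ c)
    same-fibre c = does-⇔ (mk⇔ (λ gc≡v → g-injective (trans gc₀≡v (sym gc≡v)))
                               (λ c₀≡c → trans (cong g (sym c₀≡c)) gc₀≡v))
                          (g c ≟ᵥ v) (c₀ ≟ᵥ c)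

subspace-count : ∀ {ℓ d} {H : 𝔽₂^ ℓ → Bool} → IsSubspaceOfDim d H → count ℓ H ≡ 2 ^ d
subspace-count (bs , indep , span) = count-image (λ c → linComb c bs) (linComb-injective indep) span

subspace-+ᵥ-closed : ∀ {ℓ d} {H : 𝔽₂^ ℓ → Bool} → IsSubspaceOfDim d H →
  ∀ {u v} → H u ≡ true → H v ≡ true → H (u +ᵥ v) ≡ true
subspace-+ᵥ-closed (bs , _ , span) {u} {v} Hu Hv with proj₁ (span u) Hu | proj₁ (span v) Hv
... | c , c↦u | c′ , c′↦v =
  proj₂ (span (u +ᵥ v)) (c +ᵥ c′ , trans (linComb-+ᵥ c c′ bs) (cong₂ _+ᵥ_ c↦u c′↦v))

IsLinearForm : ∀ {ℓ} → (𝔽₂^ ℓ → Bool) → Set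
IsLinearForm f = ∀ u v → f (u +ᵥ v) ≡ f u xor f v

linearForm-0ᵥ : ∀ {ℓ} {f : 𝔽₂^ ℓ → Bool} → IsLinearForm f → f 0ᵥ ≡ false
linearForm-0ᵥ {f = f} linear = begin
  f 0ᵥ          ≡⟨ cong f (+ᵥ-identityˡ 0ᵥ) ⟨
  f (0ᵥ +ᵥ 0ᵥ)  ≡⟨ linear 0ᵥ 0ᵥ ⟩
  f 0ᵥ xor f 0ᵥ ≡⟨ xor-same (f 0ᵥ) ⟩
  false         ∎
  where open ≡-Reasoning

xor-linearForm : ∀ {ℓ} {f g : 𝔽₂^ ℓ → Bool} → IsLinearForm f → IsLinearForm g →
  IsLinearForm (λ v → f v xor g v)
xor-linearForm {f = f} {g} f-linear g-linear u v =
  trans (cong₂ _xor_ (f-linear u v) (g-linear u v)) (xor-interchange (f u) (f v) (g u) (g v))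

-- Translating by a vector w with f w = true swaps f and not ∘ f.
linearForm-count : ∀ {m} {f : 𝔽₂^ (suc m) → Bool} → IsLinearForm f →
  ∀ {w} → f w ≡ true → count (suc m) f ≡ 2 ^ m
linearForm-count {m} {f} linear {w} fw = *-cancelˡ-≡ _ _ 2 (begin
  2 * count (suc m) f                       ≡⟨ cong (count (suc m) f +_) (+-identityʳ _) ⟩
  count (suc m) f + count (suc m) f         ≡⟨ cong (count (suc m) f +_) translate ⟩
  count (suc m) f + count (suc m) (not ∘ f) ≡⟨ count-complement (suc m) f ⟩
  2 * 2 ^ m                                 ∎)
  where
  open ≡-Reasoning
  f[w+v]≡not[fv] : ∀ v → f (w +ᵥ v) ≡ not (f v)
  f[w+v]≡not[fv] v = trans (linear w v) (cong (_xor f v) fw)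
  translate : count (suc m) f ≡ count (suc m) (not ∘ f)
  translate = begin
    count (suc m) f                     ≡⟨ sumᵥ-translate (suc m) w (𝟙 ∘ f) ⟨
    sumᵥ (suc m) (λ v → 𝟙 (f (w +ᵥ v))) ≡⟨ sumᵥ-cong (suc m) (cong 𝟙 ∘ f[w+v]≡not[fv]) ⟩
    count (suc m) (not ∘ f)             ∎

x+y≡n∧x+z≡n∧y+z≡n⇒x+x≡n : ∀ {x y z n} → x + y ≡ n → x + z ≡ n → y + z ≡ n → x + x ≡ n
x+y≡n∧x+z≡n∧y+z≡n⇒x+x≡n {x} {y} {z} {n} x+y≡n x+z≡n y+z≡n = +-cancelʳ-≡ n (x + x) n (begin
  (x + x) + n       ≡⟨ cong (x + x +_) y+z≡n ⟨
  (x + x) + (y + z) ≡⟨ +-interchange x x y z ⟩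
  (x + y) + (x + z) ≡⟨ cong₂ _+_ x+y≡n x+z≡n ⟩
  n + n             ∎)
  where open ≡-Reasoning

-- Two linear forms with 2^m ones each meet in 2^m points (equal forms) or in 2^(m-1)
-- points (otherwise f xor g is again such a form).
count-∧-linearForms : ∀ {m} {f g : 𝔽₂^ (suc m) → Bool} → IsLinearForm f → IsLinearForm g →
  count (suc m) f ≡ 2 ^ m → count (suc m) g ≡ 2 ^ m →
  2 ^ m ≤ count (suc m) (λ v → f v ∧ g v) + count (suc m) (λ v → f v ∧ g v)
count-∧-linearForms {m} {f} {g} f-linear g-linear |f| |g|
  with false-everywhere⊎true-somewhere (suc m) (λ v → f v xor g v)
... | inj₁ f≡g = m≤n⇒m≤n+o _ (≤-reflexive (sym |f∧g|))
  where
  ∧-self : ∀ a b → a xor b ≡ false → a ∧ b ≡ a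
  ∧-self true  true  _ = refl
  ∧-self false _     _ = refl
  |f∧g| : count (suc m) (λ v → f v ∧ g v) ≡ 2 ^ m
  |f∧g| = trans (sumᵥ-cong (suc m) (λ v → cong 𝟙 (∧-self (f v) (g v) (f≡g v)))) |f|
... | inj₂ (w , fw≢gw) = ≤-reflexive (sym (x+y≡n∧x+z≡n∧y+z≡n⇒x+x≡n {both} {f-only} {g-only}
        (trans (sym (count-splitʳ (suc m) f g)) |f|)
        (trans (sym (count-splitˡ (suc m) f g)) |g|)
        (trans (sym (count-xor (suc m) f g)) |f⊕g|)))
  where
  both f-only g-only : ℕ
  both   = count (suc m) (λ v → f v ∧ g v)
  f-only = count (suc m) (λ v → f v ∧ not (g v))
  g-only = count (suc m) (λ v → not (f v) ∧ g v)
  |f⊕g| : count (suc m) (λ v → f v xor g v) ≡ 2 ^ m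
  |f⊕g| = linearForm-count {f = λ v → f v xor g v}
            (xor-linearForm {f = f} {g} f-linear g-linear) fw≢gw

-- H and its translate u + H are disjoint and each contain half of the space.
hyperplane-coset : ∀ {m} {H : 𝔽₂^ (suc m) → Bool} → IsSubspaceOfDim m H →
  ∀ {u} → H u ≡ false → ∀ v → H v ∨ H (u +ᵥ v) ≡ true
hyperplane-coset {m} {H} S {u} Hu = count≡2^ℓ⇒true (suc m) covered (begin
  count (suc m) covered
    ≡⟨ count-partition (suc m) covered H (H ∘ (u +ᵥ_)) disjoint ⟩
  count (suc m) H + count (suc m) (H ∘ (u +ᵥ_))
    ≡⟨ cong (count (suc m) H +_) (sumᵥ-translate (suc m) u (𝟙 ∘ H)) ⟩
  count (suc m) H + count (suc m) H
    ≡⟨ cong₂ _+_ |H| (trans |H| (sym (+-identityʳ _))) ⟩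
  2 ^ suc m
    ∎)
  where
  open ≡-Reasoning
  covered : 𝔽₂^ (suc m) → Bool
  covered v = H v ∨ H (u +ᵥ v)
  |H| : count (suc m) H ≡ 2 ^ m
  |H| = subspace-count S
  disjoint : ∀ v → 𝟙 (covered v) ≡ 𝟙 (H v) + 𝟙 (H (u +ᵥ v))
  disjoint v with H v in Hv | H (u +ᵥ v) in Hu+v
  ... | true  | true  = true≡false-elim
    (subst (λ z → H z ≡ true) (+ᵥ-cancelʳ u v) (subspace-+ᵥ-closed S Hu+v Hv)) Hu
  ... | true  | false = refl
  ... | false | _     = refl

hyperplane-complement-linear : ∀ {m} {H : 𝔽₂^ (suc m) → Bool} → IsSubspaceOfDim m H →
  IsLinearForm (not ∘ H)
hyperplane-complement-linear {H = H} S u v with H u in Hu | H v in Hv | H (u +ᵥ v) in Hu+v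
... | true  | true  | true  = refl
... | true  | true  | false = true≡false-elim (subspace-+ᵥ-closed S Hu Hv) Hu+v
... | true  | false | true  = true≡false-elim
  (subst (λ z → H z ≡ true) (+ᵥ-cancelˡ u v) (subspace-+ᵥ-closed S Hu Hu+v)) Hv
... | true  | false | false = refl
... | false | true  | true  = true≡false-elim
  (subst (λ z → H z ≡ true) (+ᵥ-cancelʳ u v) (subspace-+ᵥ-closed S Hu+v Hv)) Hu
... | false | true  | false = refl
... | false | false | true  = refl
... | false | false | false = true≡false-elim (hyperplane-coset S Hu v) (cong₂ _∨_ Hv Hu+v)

hyperplane-complement-count : ∀ {m} {H : 𝔽₂^ (suc m) → Bool} → IsSubspaceOfDim m H →
  count (suc m) (not ∘ H) ≡ 2 ^ m
hyperplane-complement-count {m} {H} S = +-cancelˡ-≡ (count (suc m) H) _ _ (begin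
  count (suc m) H + count (suc m) (not ∘ H) ≡⟨ count-complement (suc m) H ⟩
  2 ^ m + (2 ^ m + 0)                       ≡⟨ cong₂ _+_ (sym (subspace-count S)) (+-identityʳ _) ⟩
  count (suc m) H + 2 ^ m                   ∎)
  where open ≡-Reasoning

module HyperplaneFamily {m : ℕ} (X : Fin (2 ^ suc m ∸ 1) → 𝔽₂^ (suc m) → Bool)
  (hyperplanes : ∀ k → IsSubspaceOfDim m (X k))
  (regular : ∀ v → v ≢ 0ᵥ → countTrue (λ k → X k v) ≡ 2 ^ m ∸ 1)
  where

  N : ℕ
  N = 2 ^ suc m ∸ 1

  N+1≡2^m+2^m : N + 1 ≡ 2 ^ m + 2 ^ m
  N+1≡2^m+2^m = trans (m∸n+n≡m (m^n>0 2 (suc m))) (cong (2 ^ m +_) (+-identityʳ (2 ^ m)))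

  outside : Fin N → 𝔽₂^ (suc m) → Bool
  outside k v = not (X k v)

  outside-linear : ∀ k → IsLinearForm (outside k)
  outside-linear k = hyperplane-complement-linear (hyperplanes k)

  outside-count : ∀ k → count (suc m) (outside k) ≡ 2 ^ m
  outside-count k = hyperplane-complement-count (hyperplanes k)

  outside-regular : ∀ v → v ≢ 0ᵥ → ∑[ k < N ] 𝟙 (outside k v) ≡ 2 ^ m
  outside-regular v v≢0 = trans (+-cancelˡ-≡ (2 ^ m ∸ 1) _ _ (begin
    (2 ^ m ∸ 1) + ∑[ k < N ] 𝟙 (outside k v)
      ≡⟨ cong (_+ ∑[ k < N ] 𝟙 (outside k v))
              (trans (sym (regular v v≢0)) (countTrue≡∑ (λ k → X k v))) ⟩
    ∑[ k < N ] 𝟙 (X k v) + ∑[ k < N ] 𝟙 (not (X k v))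
      ≡⟨ ∑-𝟙-complement (λ k → X k v) ⟩
    N
      ≡⟨ +-∸-comm (2 ^ m + 0) (m^n>0 2 m) ⟩
    (2 ^ m ∸ 1) + (2 ^ m + 0)
      ∎)) (+-identityʳ (2 ^ m))
    where open ≡-Reasoning

  meet : Fin N → Fin N → ℕ
  meet i k = count (suc m) (λ v → outside i v ∧ outside k v)

  ∑-meet : ∀ i → ∑[ k < N ] meet i k ≡ 2 ^ m * 2 ^ m
  ∑-meet i = trans (∑-count-∧ (outside i) outside (λ v oᵢv → outside-regular v (nonzero oᵢv)))
                   (cong (_* 2 ^ m) (outside-count i))
    where
    nonzero : ∀ {v} → outside i v ≡ true → v ≢ 0ᵥ
    nonzero oᵢv refl = true≡false-elim oᵢv (linearForm-0ᵥ {f = outside i} (outside-linear i))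

  2^m≤meet+meet : ∀ i k → 2 ^ m ≤ meet i k + meet i k
  2^m≤meet+meet i k = count-∧-linearForms {f = outside i} {outside k}
    (outside-linear i) (outside-linear k) (outside-count i) (outside-count k)

  meet-≗ : ∀ {i j} → (∀ v → X i v ≡ X j v) → meet i j ≡ 2 ^ m
  meet-≗ {i} {j} Xᵢ≗Xⱼ = trans (sumᵥ-cong (suc m) (cong 𝟙 ∘ meet-self)) (outside-count i)
    where
    meet-self : ∀ v → outside i v ∧ outside j v ≡ outside i v
    meet-self v = trans (cong (λ b → outside i v ∧ not b) (sym (Xᵢ≗Xⱼ v))) (∧-idem (outside i v))

no-room : ∀ {N M} → N + 1 ≡ M + M → 0 < M → N * M + (M + M) ≰ M * M + M * M
no-room {N} {M} N+1≡M+M 0<M too-big = <⇒≱ (m<m+n (M * M + M * M) 0<M) (begin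
  M * M + M * M + M ≡⟨ expand M ⟨
  (M + M) * M + M   ≡⟨ cong (λ t → t * M + M) N+1≡M+M ⟨
  (N + 1) * M + M   ≡⟨ regroup N M ⟩
  N * M + (M + M)   ≤⟨ too-big ⟩
  M * M + M * M     ∎)
  where
  open ≤-Reasoning
  expand : ∀ M → (M + M) * M + M ≡ M * M + M * M + M
  expand = solve-∀
  regroup : ∀ N M → (N + 1) * M + M ≡ N * M + (M + M)
  regroup = solve-∀

mainTheorem12 : (ℓ : ℕ) → 1 ≤ ℓ →
    (X : Fin (2 ^ ℓ ∸ 1) → (𝔽₂^ ℓ → Bool)) →
    (∀ i → IsSubspaceOfDim (ℓ ∸ 1) (X i)) →
    (∀ (v : 𝔽₂^ ℓ) → v ≢ 0ᵥ → countTrue (λ i → X i v) ≡ 2 ^ (ℓ ∸ 1) ∸ 1) →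
    ∀ (i j : Fin (2 ^ ℓ ∸ 1)) → i ≢ j → ¬ (∀ (v : 𝔽₂^ ℓ) → X i v ≡ X j v)
mainTheorem12 (suc m) _ X hyperplanes regular i j i≢j Xᵢ≗Xⱼ =
  no-room N+1≡2^m+2^m (m^n>0 2 m) (begin
    N * M + (M + M)
      ≡⟨ cong₂ (λ s t → N * M + (s + t)) (excess (meet-≗ λ _ → refl)) (excess (meet-≗ Xᵢ≗Xⱼ)) ⟨
    N * M + ((twice i ∸ M) + (twice j ∸ M))
      ≤⟨ ∑-lower-bound twice i≢j (2^m≤meet+meet i) ⟩
    ∑[ k < N ] twice k
      ≡⟨ ∑-distrib-+ (meet i) (meet i) ⟩
    ∑[ k < N ] meet i k + ∑[ k < N ] meet i k
      ≡⟨ cong₂ _+_ (∑-meet i) (∑-meet i) ⟩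
    M * M + M * M
      ∎)
  where
  open HyperplaneFamily X hyperplanes regular
  open ≤-Reasoning
  M : ℕ
  M = 2 ^ m
  twice : Fin N → ℕ
  twice k = meet i k + meet i k
  excess : ∀ {k} → meet i k ≡ M → twice k ∸ M ≡ M
  excess meet≡M = trans (cong (λ t → t + t ∸ M) meet≡M) (m+n∸n≡m M M)
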